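{- For every $n\ge 10$, Breaker cannot win the triangle game $\mathcal{F}_{K_3}(E_b,n)$ even with the maximal matching bias $b=\lfloor n/2\rfloor$; that is, Maker has a winning strategy (with Breaker moving first).
   Context: $\mathcal{F}_{K_3}(E_b,n)$ is the following game on the edge set of $K_n$: players alternate; on each turn Maker claims one unclaimed edge, and Breaker claims a set of at most $b$ pairwise vertex-disjoint unclaimed edges (a subgraph of a matching of size $b$). The game ends when no unclaimed edges remain. Maker wins if her graph contains a triangle; otherwise Breaker wins. -}

module Defs where

open import Data.Nat using (ℕ; _≤_; ⌊_/2⌋)
open import Data.Fin using (Fin; _<_)
open import Data.Product using (_×_; _,_; proj₁; proj₂; ∃)
open import Data.List using (List; []; _∷_; _++_; length)
open import Data.List.Membership.Propositional using (_∈_; _∉_)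
open import Data.List.Relation.Unary.All using (All)
open import Data.List.Relation.Unary.AllPairs using (AllPairs)
open import Relation.Binary.PropositionalEquality using (_≢_)

-- An edge of K_n on vertex set Fin n is stored as an ordered pair (i , j)
-- with i < j (so each edge has a unique representation).
Edge : ℕ → Set
Edge n = Fin n × Fin n

IsEdge : ∀ {n} → Edge n → Set
IsEdge (i , j) = i < j

Unclaimed : ∀ {n} → List (Edge n) → List (Edge n) → Edge n → Set
Unclaimed M B e = IsEdge e × e ∉ M × e ∉ B

VDisjoint : ∀ {n} → Edge n → Edge n → Set
VDisjoint (a , b) (c , d) = a ≢ c × a ≢ d × b ≢ c × b ≢ d

LegalBreakerMove : ∀ {n} → ℕ → List (Edge n) → List (Edge n) → List (Edge n) → Set
LegalBreakerMove b M B S =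
  All (Unclaimed M B) S × AllPairs VDisjoint S × length S ≤ b

HasTriangle : ∀ {n} → List (Edge n) → Set
HasTriangle {n} M = ∃ λ (x : Fin n) → ∃ λ (y : Fin n) → ∃ λ (z : Fin n) →
  x < y × y < z × (x , y) ∈ M × (y , z) ∈ M × (x , z) ∈ M

-- The predicates are inductive, so an
-- inhabitant is a (well-founded) winning strategy for Maker.
-- If no unclaimed edge remains, the game is over and Maker cannot make a
-- move, so she wins only if she already has a triangle.
mutual
  data MakerWinsB {n : ℕ} (b : ℕ) (M B : List (Edge n)) : Set where
    doneB : HasTriangle M → MakerWinsB b M B
    stepB : (∀ S → LegalBreakerMove b M B S → MakerWinsM b M (S ++ B))
          → MakerWinsB b M B

  data MakerWinsM {n : ℕ} (b : ℕ) (M B : List (Edge n)) : Set where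
    doneM : HasTriangle M → MakerWinsM b M B
    stepM : (e : Edge n) → Unclaimed M B e → MakerWinsB b (e ∷ M) B
          → MakerWinsM b M B

MakerWinsTriangleGame : ℕ → ℕ → Set
MakerWinsTriangleGame n b = MakerWinsB {n} b [] []

-- Maker first claims an edge va with a not adjacent to v in Breaker's graph, so
-- at her second move Breaker's graph B has maximum degree 2.  She then builds a
-- cherry o–c–z whose closing edge oz is Breaker's, and claims cy for a vertex y
-- with cy, oy, zy all unclaimed: a matching cannot block both oy and zy.  Such a
-- y exists as soon as c, o, z, their B-neighbours and their neighbours in
-- Breaker's next reply cover at most 9 < n vertices.  Let X = {v, a} ∪ N(v) ∪ N(a).
-- If some z ∉ X has at most 7 − |X| neighbours outside X, Maker claims vz: unless
-- Breaker takes az she completes vaz, and if he does, his matching is spent at a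
-- and z.  Otherwise |X| = 6, and for z ∈ N(v) every neighbour of z lies in X;
-- Maker claims az, and the cherry v–a–z is already closed by Breaker's edge vz.
module Submission where

open import Defs
open import Data.Nat as ℕ using (ℕ; suc; _+_; _≤_; _≤?_; ⌊_/2⌋; z≤n; s≤s; s≤s⁻¹)
open import Data.Nat.Properties as ℕₚ
  using (m≤m+n; ≤-trans; ≤-antisym; +-mono-≤; +-monoˡ-≤; +-monoʳ-≤; +-cancelˡ-≤; +-cancelʳ-≤; ≰⇒>)
open import Data.Fin using (Fin; _<_; fromℕ<)
open import Data.Fin.Properties using (_≟_; <-cmp; any?; pigeonhole; <-irrefl; <-asym; <-trans)
open import Data.Product using (_×_; _,_; proj₁; proj₂; ∃)
open import Data.Product.Properties using (≡-dec)
open import Data.Sum using (_⊎_; inj₁; inj₂; [_,_]′)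
open import Data.Empty using (⊥; ⊥-elim)
open import Function using (_∘_)
open import Data.List using (List; []; _∷_; _++_; length; filter; lookup)
open import Data.List.Properties using (length-++; length-filter; filter-notAll; ++-assoc)
open import Data.List.Membership.Propositional using (_∈_; _∉_)
open import Data.List.Membership.Propositional.Properties using (∈-++⁻; ∈-++⁺ˡ; ∈-++⁺ʳ; ∈-filter⁺)
import Data.List.Membership.DecPropositional as DecMembership
open import Data.List.Relation.Unary.Any as Any using (here; there)
open import Data.List.Relation.Unary.Any.Properties using (lookup-index)
open import Data.List.Relation.Unary.All as All using (All; []; _∷_)
open import Data.List.Relation.Unary.All.Properties using (++⁺)
open import Data.List.Relation.Unary.AllPairs using (AllPairs; []; _∷_)
open import Relation.Binary.Definitions using (Tri; tri<; tri≈; tri>)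
open import Relation.Binary.PropositionalEquality using (_≡_; _≢_; ≢-sym; refl; sym; trans; cong; subst)
open import Relation.Nullary using (¬_; Dec; yes; no; ¬?)
open import Relation.Nullary.Decidable using (decidable-stable; _×-dec_; _⊎-dec_)

private variable
  n b : ℕ
  x y z c o p q r u : Fin n
  e f : Edge n
  M B S : List (Edge n)

∉-∷ : ∀ {A : Set} {a s : A} {xs : List A} → a ≢ s → a ∉ xs → a ∉ s ∷ xs
∉-∷ a≢s a∉xs (here a≡s) = a≢s a≡s
∉-∷ a≢s a∉xs (there a∈xs) = a∉xs a∈xs

∉-++ : ∀ {A : Set} {a : A} (xs : List A) {ys : List A} → a ∉ xs → a ∉ ys → a ∉ xs ++ ys
∉-++ xs a∉xs a∉ys a∈xs++ys with ∈-++⁻ xs a∈xs++ys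
... | inj₁ a∈xs = a∉xs a∈xs
... | inj₂ a∈ys = a∉ys a∈ys

allPairs-∈ : ∀ {A : Set} {R : A → A → Set} {xs : List A} {s t : A} →
             AllPairs R xs → s ∈ xs → t ∈ xs → s ≡ t ⊎ R s t ⊎ R t s
allPairs-∈ (_ ∷ _) (here refl) (here refl) = inj₁ refl
allPairs-∈ (s#xs ∷ _) (here refl) (there t∈xs) = inj₂ (inj₁ (All.lookup s#xs t∈xs))
allPairs-∈ (t#xs ∷ _) (there s∈xs) (here refl) = inj₂ (inj₂ (All.lookup t#xs s∈xs))
allPairs-∈ (_ ∷ xs-pairs) (there s∈xs) (there t∈xs) = allPairs-∈ xs-pairs s∈xs t∈xs

≤-+-saturated : ∀ {d r k m} → d ≤ k → r ≤ m → k + m ≤ d + r → d ≡ k × r ≡ m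
≤-+-saturated {d} {r} {k} {m} d≤k r≤m k+m≤d+r =
  ≤-antisym d≤k (+-cancelʳ-≤ m k d (≤-trans k+m≤d+r (+-monoʳ-≤ d r≤m))) ,
  ≤-antisym r≤m (+-cancelˡ-≤ k m r (≤-trans k+m≤d+r (+-monoˡ-≤ r d≤k)))

_∈?_ : (y : Fin n) (L : List (Fin n)) → Dec (y ∈ L)
_∈?_ = DecMembership._∈?_ _≟_

_∖_ : List (Fin n) → List (Fin n) → List (Fin n)
Q ∖ P = filter (λ y → ¬? (y ∈? P)) Q

∈-++-∖ : (P Q : List (Fin n)) → y ∈ Q → y ∈ P ++ (Q ∖ P)
∈-++-∖ {y = y} P Q y∈Q with y ∈? P
... | yes y∈P = ∈-++⁺ˡ y∈P
... | no y∉P = ∈-++⁺ʳ P (∈-filter⁺ (λ y → ¬? (y ∈? P)) y∈Q y∉P)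

length-∖ : (P Q : List (Fin n)) → length (Q ∖ P) ≤ length Q
length-∖ P = length-filter (λ y → ¬? (y ∈? P))

length-∖-< : (P Q : List (Fin n)) → y ∈ Q → y ∈ P → length (Q ∖ P) ℕ.< length Q
length-∖-< P Q y∈Q y∈P =
  filter-notAll (λ y → ¬? (y ∈? P)) Q (Any.map (λ { refl y∉P → y∉P y∈P }) y∈Q)

length≡suc⇒∃∈ : ∀ {A : Set} {k} (xs : List A) → length xs ≡ suc k → ∃ λ a → a ∈ xs
length≡suc⇒∃∈ (a ∷ _) _ = a , here refl

length<n⇒∃∉ : ∀ {n} (L : List (Fin n)) → length L ℕ.< n → ∃ λ y → y ∉ L
length<n⇒∃∉ {n} L L<n with any? (λ (y : Fin n) → ¬? (y ∈? L))
... | yes missing = missing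
... | no ¬missing = ⊥-elim (position-not-injective (pigeonhole L<n position))
  where
  everywhere : (y : Fin n) → y ∈ L
  everywhere y = decidable-stable (y ∈? L) (λ y∉L → ¬missing (y , y∉L))
  position : Fin n → Fin (length L)
  position y = Any.index (everywhere y)
  position-not-injective : ∃ (λ i → ∃ λ j → i < j × position i ≡ position j) → ⊥
  position-not-injective (i , j , i<j , same) =
    <-irrefl (trans (lookup-index (everywhere i))
                    (trans (cong (lookup L) same) (sym (lookup-index (everywhere j))))) i<j

-- Edges of K_n

-- For x ≡ y this is the pair (x , x), which is not an IsEdge.
edge : Fin n → Fin n → Edge n
edge x y with <-cmp x y
... | tri< _ _ _ = x , y
... | tri≈ _ _ _ = x , y
... | tri> _ _ _ = y , x

edge-< : x < y → edge x y ≡ (x , y)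
edge-< {x = x} {y} x<y with <-cmp x y
... | tri< _ _ _ = refl
... | tri≈ _ x≡y _ = ⊥-elim (<-irrefl x≡y x<y)
... | tri> _ _ y<x = ⊥-elim (<-asym x<y y<x)

edge-> : y < x → edge x y ≡ (y , x)
edge-> {y = y} {x} y<x with <-cmp x y
... | tri< x<y _ _ = ⊥-elim (<-asym x<y y<x)
... | tri≈ _ x≡y _ = ⊥-elim (<-irrefl (sym x≡y) y<x)
... | tri> _ _ _ = refl

edge-comm : (x y : Fin n) → edge x y ≡ edge y x
edge-comm x y = by-order (<-cmp x y)
  where
  by-order : Tri (x < y) (x ≡ y) (y < x) → edge x y ≡ edge y x
  by-order (tri< x<y _ _) = trans (edge-< x<y) (sym (edge-> x<y))
  by-order (tri≈ _ refl _) = refl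
  by-order (tri> _ _ y<x) = trans (edge-> y<x) (sym (edge-< y<x))

edge-isEdge : x ≢ y → IsEdge (edge x y)
edge-isEdge {x = x} {y} x≢y with <-cmp x y
... | tri< x<y _ _ = x<y
... | tri≈ _ x≡y _ = ⊥-elim (x≢y x≡y)
... | tri> _ _ y<x = y<x

_∈ₑ?_ : (e : Edge n) (B : List (Edge n)) → Dec (e ∈ B)
_∈ₑ?_ = DecMembership._∈?_ (≡-dec _≟_ _≟_)

Endpoint : Fin n → Edge n → Set
Endpoint x e = x ≡ proj₁ e ⊎ x ≡ proj₂ e

endpointˡ : (x y : Fin n) → Endpoint x (edge x y)
endpointˡ x y with <-cmp x y
... | tri< _ _ _ = inj₁ refl
... | tri≈ _ _ _ = inj₁ refl
... | tri> _ _ _ = inj₂ refl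

endpointʳ : (x y : Fin n) → Endpoint y (edge x y)
endpointʳ x y = subst (Endpoint y) (edge-comm y x) (endpointˡ y x)

endpoint-edge : Endpoint u (edge x y) → u ≡ x ⊎ u ≡ y
endpoint-edge {x = x} {y} u∈xy with <-cmp x y | u∈xy
... | tri< _ _ _ | u≡x/y = u≡x/y
... | tri≈ _ _ _ | u≡x/y = u≡x/y
... | tri> _ _ _ | inj₁ u≡y = inj₂ u≡y
... | tri> _ _ _ | inj₂ u≡x = inj₁ u≡x

endpoint? : (x : Fin n) (e : Edge n) → Dec (Endpoint x e)
endpoint? x (i , j) = (x ≟ i) ⊎-dec (x ≟ j)

¬endpoint-edge : u ≢ x → u ≢ y → ¬ Endpoint u (edge x y)
¬endpoint-edge u≢x u≢y u∈xy with endpoint-edge u∈xy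
... | inj₁ u≡x = u≢x u≡x
... | inj₂ u≡y = u≢y u≡y

edge-≢ : x ≢ p → x ≢ q → edge x y ≢ edge p q
edge-≢ {x = x} {y = y} x≢p x≢q xy≡pq =
  ¬endpoint-edge x≢p x≢q (subst (Endpoint x) xy≡pq (endpointˡ x y))

edge-≢ʳ : y ≢ p → y ≢ q → edge x y ≢ edge p q
edge-≢ʳ {y = y} {x = x} y≢p y≢q xy≡pq = edge-≢ y≢p y≢q (trans (edge-comm y x) xy≡pq)

vdisjoint⇒¬endpoint : VDisjoint e f → Endpoint x e → Endpoint x f → ⊥
vdisjoint⇒¬endpoint (a≢c , a≢d , b≢c , b≢d) (inj₁ refl) (inj₁ refl) = a≢c refl
vdisjoint⇒¬endpoint (a≢c , a≢d , b≢c , b≢d) (inj₁ refl) (inj₂ refl) = a≢d refl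
vdisjoint⇒¬endpoint (a≢c , a≢d , b≢c , b≢d) (inj₂ refl) (inj₁ refl) = b≢c refl
vdisjoint⇒¬endpoint (a≢c , a≢d , b≢c , b≢d) (inj₂ refl) (inj₂ refl) = b≢d refl

matching-shared-endpoint : AllPairs VDisjoint S → e ∈ S → f ∈ S →
                           Endpoint x e → Endpoint x f → e ≡ f
matching-shared-endpoint S-matching e∈S f∈S x∈e x∈f with allPairs-∈ S-matching e∈S f∈S
... | inj₁ e≡f = e≡f
... | inj₂ (inj₁ e#f) = ⊥-elim (vdisjoint⇒¬endpoint e#f x∈e x∈f)
... | inj₂ (inj₂ f#e) = ⊥-elim (vdisjoint⇒¬endpoint f#e x∈f x∈e)

-- Neighbourhoods

neighboursVia : Fin n → Edge n → List (Fin n)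
neighboursVia x (i , j) with i ≟ x
... | yes _ = j ∷ []
... | no _ with j ≟ x
...   | yes _ = i ∷ []
...   | no _ = []

neighbours : Fin n → List (Edge n) → List (Fin n)
neighbours x [] = []
neighbours x (e ∷ B) = neighboursVia x e ++ neighbours x B

degree : Fin n → List (Edge n) → ℕ
degree x B = length (neighbours x B)

neighbours-++ : (x : Fin n) (A B : List (Edge n)) →
                neighbours x (A ++ B) ≡ neighbours x A ++ neighbours x B
neighbours-++ x [] B = refl
neighbours-++ x (e ∷ A) B =
  trans (cong (neighboursVia x e ++_) (neighbours-++ x A B))
        (sym (++-assoc (neighboursVia x e) (neighbours x A) (neighbours x B)))

degree-++ : (x : Fin n) (A B : List (Edge n)) → degree x (A ++ B) ≡ degree x A + degree x B
degree-++ x A B = trans (cong length (neighbours-++ x A B)) (length-++ (neighbours x A))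

∉-neighbours-++ : (A : List (Edge n)) →
                  y ∉ neighbours x A → y ∉ neighbours x B → y ∉ neighbours x (A ++ B)
∉-neighbours-++ {y = y} {x = x} {B = B} A y∉A y∉B =
  subst (y ∉_) (sym (neighbours-++ x A B)) (∉-++ (neighbours x A) y∉A y∉B)

neighboursVia-fst : (x y : Fin n) → y ∈ neighboursVia x (x , y)
neighboursVia-fst x y with x ≟ x
... | yes _ = here refl
... | no x≢x = ⊥-elim (x≢x refl)

neighboursVia-snd : (x y : Fin n) → y ∈ neighboursVia x (y , x)
neighboursVia-snd x y with y ≟ x
... | yes y≡x = here y≡x
... | no _ with x ≟ x
...   | yes _ = here refl
...   | no x≢x = ⊥-elim (x≢x refl)

neighboursVia-sound : {i j : Fin n} → y ∈ neighboursVia x (i , j) →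
                      (i ≡ x × j ≡ y) ⊎ (j ≡ x × i ≡ y)
neighboursVia-sound {x = x} {i = i} {j} y∈ with i ≟ x
neighboursVia-sound (here refl) | yes i≡x = inj₁ (i≡x , refl)
neighboursVia-sound {x = x} {i = i} {j} y∈ | no _ with j ≟ x
neighboursVia-sound (here refl) | no _ | yes j≡x = inj₂ (j≡x , refl)
neighboursVia-sound () | no _ | no _

neighboursVia-¬endpoint : ¬ Endpoint x e → neighboursVia x e ≡ []
neighboursVia-¬endpoint {x = x} {e = i , j} x∉e with i ≟ x
... | yes i≡x = ⊥-elim (x∉e (inj₁ (sym i≡x)))
... | no _ with j ≟ x
...   | yes j≡x = ⊥-elim (x∉e (inj₂ (sym j≡x)))
...   | no _ = refl

length-neighboursVia : (x : Fin n) (e : Edge n) → length (neighboursVia x e) ≤ 1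
length-neighboursVia x (i , j) with i ≟ x
... | yes _ = s≤s z≤n
... | no _ with j ≟ x
...   | yes _ = s≤s z≤n
...   | no _ = z≤n

neighboursVia⇒neighbours : e ∈ B → y ∈ neighboursVia x e → y ∈ neighbours x B
neighboursVia⇒neighbours (here refl) y∈e = ∈-++⁺ˡ y∈e
neighboursVia⇒neighbours {B = f ∷ _} {x = x} (there e∈B) y∈e =
  ∈-++⁺ʳ (neighboursVia x f) (neighboursVia⇒neighbours e∈B y∈e)

edge∈⇒neighbour : edge x y ∈ B → y ∈ neighbours x B
edge∈⇒neighbour {x = x} {y} {B} xy∈B with <-cmp x y
... | tri< _ _ _ = neighboursVia⇒neighbours xy∈B (neighboursVia-fst x y)
... | tri≈ _ _ _ = neighboursVia⇒neighbours xy∈B (neighboursVia-fst x y)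
... | tri> _ _ _ = neighboursVia⇒neighbours xy∈B (neighboursVia-snd x y)

neighbour⇒pair∈ : (B : List (Edge n)) → y ∈ neighbours x B → (x , y) ∈ B ⊎ (y , x) ∈ B
neighbour⇒pair∈ {x = x} ((i , j) ∷ B) y∈ with ∈-++⁻ (neighboursVia x (i , j)) y∈
... | inj₁ y∈e with neighboursVia-sound {i = i} {j} y∈e
...   | inj₁ (refl , refl) = inj₁ (here refl)
...   | inj₂ (refl , refl) = inj₂ (here refl)
neighbour⇒pair∈ {x = x} (_ ∷ B) y∈ | inj₂ y∈B with neighbour⇒pair∈ B y∈B
...   | inj₁ xy∈B = inj₁ (there xy∈B)
...   | inj₂ yx∈B = inj₂ (there yx∈B)

neighbour⇒edge∈ : All IsEdge B → y ∈ neighbours x B → edge x y ∈ B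
neighbour⇒edge∈ {B = B} {y = y} {x = x} B-edges y∈ with neighbour⇒pair∈ B y∈
... | inj₁ xy∈B = subst (_∈ B) (sym (edge-< (All.lookup B-edges xy∈B))) xy∈B
... | inj₂ yx∈B = subst (_∈ B) (sym (edge-> (All.lookup B-edges yx∈B))) yx∈B

neighbour-sym : All IsEdge B → y ∈ neighbours x B → x ∈ neighbours y B
neighbour-sym {B = B} {y = y} {x = x} B-edges y∈ =
  edge∈⇒neighbour (subst (_∈ B) (edge-comm x y) (neighbour⇒edge∈ B-edges y∈))

neighbour⇒≢ : All IsEdge B → y ∈ neighbours x B → y ≢ x
neighbour⇒≢ {B = B} B-edges y∈ refl with neighbour⇒pair∈ B y∈
... | inj₁ yy∈B = <-irrefl refl (All.lookup B-edges yy∈B)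
... | inj₂ yy∈B = <-irrefl refl (All.lookup B-edges yy∈B)

disjoint⇒neighbours≡[] : All (VDisjoint e) S → Endpoint x e → neighbours x S ≡ []
disjoint⇒neighbours≡[] [] x∈e = refl
disjoint⇒neighbours≡[] {e = e} {S = f ∷ S} {x = x} (e#f ∷ e#S) x∈e =
  trans (cong (_++ neighbours x S) (neighboursVia-¬endpoint (vdisjoint⇒¬endpoint e#f x∈e)))
        (disjoint⇒neighbours≡[] e#S x∈e)

matching-degree≤1 : AllPairs VDisjoint S → degree x S ≤ 1
matching-degree≤1 [] = z≤n
matching-degree≤1 {S = e ∷ S} {x = x} (e#S ∷ S-matching)
  rewrite length-++ (neighboursVia x e) {neighbours x S} with endpoint? x e
... | yes x∈e rewrite disjoint⇒neighbours≡[] e#S x∈e =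
  +-mono-≤ (length-neighboursVia x e) z≤n
... | no x∉e rewrite neighboursVia-¬endpoint x∉e = matching-degree≤1 S-matching

matching-neighbour-unique : All IsEdge S → AllPairs VDisjoint S →
                            edge x z ∈ S → y ∈ neighbours x S → y ≡ z
matching-neighbour-unique {x = x} {z = z} {y = y} S-edges S-matching xz∈S y∈ =
  [ (λ y≡x → ⊥-elim (neighbour⇒≢ S-edges y∈ y≡x)) , (λ y≡z → y≡z) ]′
    (endpoint-edge (subst (Endpoint y) xy≡xz (endpointʳ x y)))
  where
  xy≡xz : edge x y ≡ edge x z
  xy≡xz = matching-shared-endpoint S-matching (neighbour⇒edge∈ S-edges y∈) xz∈S
                                   (endpointˡ x y) (endpointˡ x z)

-- Winning positions

legal-edges : LegalBreakerMove b M B S → All IsEdge B → All IsEdge (S ++ B)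
legal-edges (S-unclaimed , _) B-edges = ++⁺ (All.map proj₁ S-unclaimed) B-edges

legal-degree : ∀ {k} → LegalBreakerMove b M B S → degree x B ≤ k → degree x (S ++ B) ≤ suc k
legal-degree {B = B} {S = S} {x = x} (_ , S-matching , _) deg≤k =
  subst (_≤ _) (sym (degree-++ x S B)) (+-mono-≤ (matching-degree≤1 S-matching) deg≤k)

legal-∉ : LegalBreakerMove b M B S → e ∈ M → e ∉ B → e ∉ S ++ B
legal-∉ {S = S} (S-unclaimed , _) e∈M e∉B =
  ∉-++ S (λ e∈S → proj₁ (proj₂ (All.lookup S-unclaimed e∈S)) e∈M) e∉B

unclaimed-after : Unclaimed M B e → e ≢ f → e ∉ S → Unclaimed (f ∷ M) (S ++ B) e
unclaimed-after {S = S} (e-edge , e∉M , e∉B) e≢f e∉S =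
  e-edge , ∉-∷ e≢f e∉M , ∉-++ S e∉S e∉B

∈-edge-comm : edge x y ∈ M → edge y x ∈ M
∈-edge-comm {x = x} {y = y} {M = M} = subst (_∈ M) (edge-comm x y)

triangle-< : x < y → y < z → edge x y ∈ M → edge y z ∈ M → edge x z ∈ M → HasTriangle M
triangle-< {M = M} x<y y<z xy∈M yz∈M xz∈M =
  _ , _ , _ , x<y , y<z , subst (_∈ M) (edge-< x<y) xy∈M , subst (_∈ M) (edge-< y<z) yz∈M
                        , subst (_∈ M) (edge-< (<-trans x<y y<z)) xz∈M

triangle : p ≢ q → q ≢ r → p ≢ r → edge p q ∈ M → edge q r ∈ M → edge p r ∈ M → HasTriangle M
triangle {p = p} {q = q} {r = r} {M = M} p≢q q≢r p≢r pq qr pr =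
  by-order (<-cmp p q) (<-cmp q r) (<-cmp p r)
  where
  by-order : Tri (p < q) (p ≡ q) (q < p) → Tri (q < r) (q ≡ r) (r < q) →
             Tri (p < r) (p ≡ r) (r < p) → HasTriangle M
  by-order (tri≈ _ p≡q _) _ _ = ⊥-elim (p≢q p≡q)
  by-order _ (tri≈ _ q≡r _) _ = ⊥-elim (q≢r q≡r)
  by-order _ _ (tri≈ _ p≡r _) = ⊥-elim (p≢r p≡r)
  by-order (tri< p<q _ _) (tri< q<r _ _) _ = triangle-< p<q q<r pq qr pr
  by-order (tri< _ _ _) (tri> _ _ r<q) (tri< p<r _ _) = triangle-< p<r r<q pr (∈-edge-comm qr) pq
  by-order (tri< p<q _ _) (tri> _ _ _) (tri> _ _ r<p) =
    triangle-< r<p p<q (∈-edge-comm pr) pq (∈-edge-comm qr)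
  by-order (tri> _ _ q<p) (tri< _ _ _) (tri< p<r _ _) = triangle-< q<p p<r (∈-edge-comm pq) pr qr
  by-order (tri> _ _ _) (tri< q<r _ _) (tri> _ _ r<p) =
    triangle-< q<r r<p qr (∈-edge-comm pr) (∈-edge-comm pq)
  by-order (tri> _ _ q<p) (tri> _ _ r<q) _ =
    triangle-< r<q q<p (∈-edge-comm qr) (∈-edge-comm pq) (∈-edge-comm pr)

Untouched : Fin n → List (Edge n) → Set
Untouched y M = All (λ e → ¬ Endpoint y e) M

untouched⇒≢ : Untouched y M → edge p q ∈ M → y ≢ p
untouched⇒≢ {p = p} {q = q} y-untouched pq∈M refl = All.lookup y-untouched pq∈M (endpointˡ p q)

untouched⇒unclaimed : Untouched y M → p ≢ y → y ∉ neighbours p B → Unclaimed M B (edge p y)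
untouched⇒unclaimed {y = y} {p = p} y-untouched p≢y y∉Np =
  edge-isEdge p≢y , (λ py∈M → All.lookup y-untouched py∈M (endpointʳ p y))
                  , (λ py∈B → y∉Np (edge∈⇒neighbour py∈B))

double-threat-wins : c ≢ o → c ≢ z → o ≢ z → edge c o ∈ M → edge c z ∈ M → Untouched y M →
                     y ∉ neighbours c B → y ∉ neighbours o B → y ∉ neighbours z B → MakerWinsM b M B
double-threat-wins {c = c} {o = o} {z = z} {M = M} {y = y} {B = B} {b = b}
             c≢o c≢z o≢z co∈M cz∈M y-untouched y∉Nc y∉No y∉Nz =
  stepM (edge c y) (untouched⇒unclaimed y-untouched c≢y y∉Nc) (stepB reply)
  where
  c≢y : c ≢ y
  c≢y c≡y = untouched⇒≢ y-untouched co∈M (sym c≡y)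
  o≢y : o ≢ y
  o≢y o≡y = untouched⇒≢ y-untouched (∈-edge-comm co∈M) (sym o≡y)
  z≢y : z ≢ y
  z≢y z≡y = untouched⇒≢ y-untouched (∈-edge-comm cz∈M) (sym z≡y)

  reply : ∀ S → LegalBreakerMove b (edge c y ∷ M) B S →
          MakerWinsM b (edge c y ∷ M) (S ++ B)
  reply S (_ , S-matching , _) with edge o y ∈ₑ? S
  ... | no oy∉S =
    stepM (edge o y)
          (unclaimed-after (untouched⇒unclaimed y-untouched o≢y y∉No)
                           (edge-≢ (≢-sym c≢o) o≢y) oy∉S)
          (doneB (triangle c≢o o≢y c≢y (there (there co∈M)) (here refl) (there (here refl))))
  ... | yes oy∈S =
    stepM (edge z y)
          (unclaimed-after (untouched⇒unclaimed y-untouched z≢y y∉Nz)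
                           (edge-≢ (≢-sym c≢z) z≢y) zy∉S)
          (doneB (triangle c≢z z≢y c≢y (there (there cz∈M)) (here refl) (there (here refl))))
    where
    zy∉S : edge z y ∉ S
    zy∉S zy∈S = edge-≢ (≢-sym o≢z) z≢y
      (matching-shared-endpoint S-matching zy∈S oy∈S (endpointʳ z y) (endpointʳ o y))

-- Maker's third move

module ThirdMove {n : ℕ} (b : ℕ) (n≥10 : 10 ≤ n) {v a : Fin n} (v≢a : v ≢ a)
                 {B : List (Edge n)} (B-edges : All IsEdge B) (va∉B : edge v a ∉ B)
                 (degree≤2 : (x : Fin n) → degree x B ≤ 2) where

  N : Fin n → List (Fin n)
  N x = neighbours x B

  P : List (Fin n)
  P = v ∷ a ∷ N v

  -- Dropping P from N a makes |X| = 6 certify that N v and N a are full and disjoint.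
  X : List (Fin n)
  X = P ++ (N a ∖ P)

  excess : Fin n → ℕ
  excess x = length (N x ∖ X)

  M₁ : List (Edge n)
  M₁ = edge v a ∷ []

  length-X : length X ≡ 2 + (degree v B + length (N a ∖ P))
  length-X = cong (λ k → 2 + k) (length-++ (N v))

  length-X≤6 : length X ≤ 6
  length-X≤6 = subst (_≤ 6) (sym length-X)
    (s≤s (s≤s (+-mono-≤ (degree≤2 v) (≤-trans (length-∖ P (N a)) (degree≤2 a)))))

  excess≤2 : (x : Fin n) → excess x ≤ 2
  excess≤2 x = ≤-trans (length-∖ X (N x)) (degree≤2 x)

  v∈X : v ∈ X
  v∈X = here refl

  a∈X : a ∈ X
  a∈X = there (here refl)

  Nv⊆X : {x : Fin n} → x ∈ N v → x ∈ X
  Nv⊆X x∈Nv = there (there (∈-++⁺ˡ x∈Nv))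

  Na⊆X : {x : Fin n} → x ∈ N a → x ∈ X
  Na⊆X = ∈-++-∖ P (N a)

  Fresh : Fin n → Set
  Fresh z = z ∉ X × length X + excess z ≤ 7

  fresh? : (z : Fin n) → Dec (Fresh z)
  fresh? z = ¬? (z ∈? X) ×-dec (length X + excess z ≤? 7)

  fresh-vertex-wins : (z : Fin n) → Fresh z → MakerWinsM b M₁ B
  fresh-vertex-wins z (z∉X , small) =
    stepM (edge v z) (untouched⇒unclaimed z-untouched (≢-sym z≢v) (z∉X ∘ Nv⊆X)) (stepB reply)
    where
    z≢v : z ≢ v
    z≢v refl = z∉X v∈X
    z≢a : z ≢ a
    z≢a refl = z∉X a∈X
    z-untouched : Untouched z M₁
    z-untouched = ¬endpoint-edge z≢v z≢a ∷ []

    M₂ : List (Edge n)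
    M₂ = edge v z ∷ M₁

    reply : (S : List (Edge n)) → LegalBreakerMove b M₂ B S → MakerWinsM b M₂ (S ++ B)
    reply S (S-unclaimed , S-matching , _) with edge a z ∈ₑ? (S ++ B)
    ... | no az∉S++B =
      stepM (edge a z)
            (edge-isEdge (≢-sym z≢a) , ∉-∷ (edge-≢ (≢-sym v≢a) (≢-sym z≢a))
                                             (∉-∷ (edge-≢ʳ z≢v z≢a) (λ ())) , az∉S++B)
            (doneB (triangle v≢a (≢-sym z≢a) (≢-sym z≢v)
                                (there (there (here refl))) (here refl) (there (here refl))))
    ... | yes az∈S++B = threat (length<n⇒∃∉ L L-short)
      where
      S-edges : All IsEdge S
      S-edges = All.map proj₁ S-unclaimed

      az∈S : edge a z ∈ S
      az∈S with ∈-++⁻ S az∈S++B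
      ... | inj₁ az∈S = az∈S
      ... | inj₂ az∈B = ⊥-elim (z∉X (Na⊆X (edge∈⇒neighbour az∈B)))

      L : List (Fin n)
      L = z ∷ neighbours v S ++ X ++ (N z ∖ X)

      L-short : length L ℕ.< n
      L-short = ≤-trans (s≤s (s≤s bound)) n≥10
        where
        bound : length (neighbours v S ++ X ++ (N z ∖ X)) ≤ 8
        bound rewrite length-++ (neighbours v S) {X ++ (N z ∖ X)} | length-++ X {N z ∖ X} =
          +-mono-≤ (matching-degree≤1 S-matching) small

      threat : ∃ (λ y → y ∉ L) → MakerWinsM b M₂ (S ++ B)
      threat (y , y∉L) =
        double-threat-wins v≢a (≢-sym z≢v) (≢-sym z≢a) (there (here refl)) (here refl) y-untouched
          (∉-neighbours-++ S (y∉L ∘ there ∘ ∈-++⁺ˡ) (y∉X ∘ Nv⊆X))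
          (∉-neighbours-++ S (y≢z ∘ matching-neighbour-unique S-edges S-matching az∈S) (y∉X ∘ Na⊆X))
          (∉-neighbours-++ S (y≢a ∘ matching-neighbour-unique S-edges S-matching (∈-edge-comm az∈S))
                             (y∉L ∘ there ∘ ∈-++⁺ʳ (neighbours v S) ∘ ∈-++-∖ X (N z)))
        where
        y∉X : y ∉ X
        y∉X = y∉L ∘ there ∘ ∈-++⁺ʳ (neighbours v S) ∘ ∈-++⁺ˡ
        y≢v : y ≢ v
        y≢v refl = y∉X v∈X
        y≢a : y ≢ a
        y≢a refl = y∉X a∈X
        y≢z : y ≢ z
        y≢z refl = y∉L (here refl)
        y-untouched : Untouched y M₂
        y-untouched = ¬endpoint-edge y≢v y≢z ∷ ¬endpoint-edge y≢v y≢a ∷ []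

  closed-cherry-wins : {z : Fin n} → z ∈ N v → z ∉ N a → ({w : Fin n} → w ∈ N z → w ∈ X) →
                       MakerWinsM b M₁ B
  closed-cherry-wins {z} z∈Nv z∉Na Nz⊆X =
    stepM (edge a z) (untouched⇒unclaimed (¬endpoint-edge z≢v z≢a ∷ []) (≢-sym z≢a) z∉Na)
          (stepB reply)
    where
    z≢v : z ≢ v
    z≢v = neighbour⇒≢ B-edges z∈Nv
    z≢a : z ≢ a
    z≢a refl = va∉B (neighbour⇒edge∈ B-edges z∈Nv)
    z∈X : z ∈ X
    z∈X = Nv⊆X z∈Nv

    M₂ : List (Edge n)
    M₂ = edge a z ∷ M₁

    reply : (S : List (Edge n)) → LegalBreakerMove b M₂ B S → MakerWinsM b M₂ (S ++ B)
    reply S (_ , S-matching , _) = threat (length<n⇒∃∉ L L-short)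
      where
      L : List (Fin n)
      L = neighbours a S ++ neighbours v S ++ neighbours z S ++ X

      L-short : length L ℕ.< n
      L-short = ≤-trans (s≤s bound) n≥10
        where
        bound : length L ≤ 9
        bound rewrite length-++ (neighbours a S) {neighbours v S ++ neighbours z S ++ X}
                    | length-++ (neighbours v S) {neighbours z S ++ X}
                    | length-++ (neighbours z S) {X} =
          +-mono-≤ (matching-degree≤1 S-matching)
            (+-mono-≤ (matching-degree≤1 S-matching)
              (+-mono-≤ (matching-degree≤1 S-matching) length-X≤6))

      threat : ∃ (λ y → y ∉ L) → MakerWinsM b M₂ (S ++ B)
      threat (y , y∉L) =
        double-threat-wins (≢-sym v≢a) (≢-sym z≢a) (≢-sym z≢v)
          (∈-edge-comm (there (here refl))) (here refl) y-untouched
          (∉-neighbours-++ S (y∉L ∘ ∈-++⁺ˡ) (y∉X ∘ Na⊆X))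
          (∉-neighbours-++ S (y∉L ∘ ∈-++⁺ʳ (neighbours a S) ∘ ∈-++⁺ˡ) (y∉X ∘ Nv⊆X))
          (∉-neighbours-++ S (y∉L ∘ ∈-++⁺ʳ (neighbours a S) ∘ ∈-++⁺ʳ (neighbours v S) ∘ ∈-++⁺ˡ)
                             (y∉X ∘ Nz⊆X))
        where
        y∉X : y ∉ X
        y∉X = y∉L ∘ ∈-++⁺ʳ (neighbours a S) ∘ ∈-++⁺ʳ (neighbours v S) ∘ ∈-++⁺ʳ (neighbours z S)
        y≢v : y ≢ v
        y≢v refl = y∉X v∈X
        y≢a : y ≢ a
        y≢a refl = y∉X a∈X
        y≢z : y ≢ z
        y≢z refl = y∉X z∈X
        y-untouched : Untouched y M₂
        y-untouched = ¬endpoint-edge y≢a y≢z ∷ ¬endpoint-edge y≢v y≢a ∷ []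

  crowded-wins : ((w : Fin n) → ¬ Fresh w) → MakerWinsM b M₁ B
  crowded-wins no-fresh =
    let z , z∈Nv = length≡suc⇒∃∈ (N v) (proj₁ saturated)
    in closed-cherry-wins z∈Nv (z∉Na z∈Nv) (Nz⊆X z∈Nv)
    where
    X-full : 6 ≤ length X
    X-full with length<n⇒∃∉ X (≤-trans (s≤s length-X≤6) (≤-trans (m≤m+n 7 3) n≥10))
    ... | w , w∉X = +-cancelʳ-≤ 2 6 (length X)
                      (≤-trans (≰⇒> (λ small → no-fresh w (w∉X , small)))
                               (+-monoʳ-≤ (length X) (excess≤2 w)))

    saturated : degree v B ≡ 2 × length (N a ∖ P) ≡ 2
    saturated = ≤-+-saturated (degree≤2 v) (≤-trans (length-∖ P (N a)) (degree≤2 a))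
                              (s≤s⁻¹ (s≤s⁻¹ (subst (6 ≤_) length-X X-full)))

    z∉Na : {z : Fin n} → z ∈ N v → z ∉ N a
    z∉Na z∈Nv z∈Na =
      ℕₚ.<-irrefl (proj₂ saturated)
        (≤-trans (length-∖-< P (N a) z∈Na (there (there z∈Nv))) (degree≤2 a))

    Nz⊆X : {z : Fin n} → z ∈ N v → {w : Fin n} → w ∈ N z → w ∈ X
    Nz⊆X z∈Nv {w} w∈Nz with w ∈? X
    ... | yes w∈X = w∈X
    ... | no w∉X = ⊥-elim (no-fresh w (w∉X , +-mono-≤ length-X≤6 (s≤s⁻¹ excess<2)))
      where
      excess<2 : excess w ℕ.< 2
      excess<2 =
        ≤-trans (length-∖-< X (N w) (neighbour-sym B-edges w∈Nz) (Nv⊆X z∈Nv)) (degree≤2 w)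

  maker-wins : MakerWinsM b M₁ B
  maker-wins with any? fresh?
  ... | yes (z , fresh) = fresh-vertex-wins z fresh
  ... | no no-fresh = crowded-wins (λ w fresh → no-fresh (w , fresh))

-- Maker's opening

maker-wins-K₃-game : (b : ℕ) → 10 ≤ n → MakerWinsB {n} b [] []
maker-wins-K₃-game {n} b n≥10 = stepB first-reply
  where
  v : Fin n
  v = fromℕ< (≤-trans (s≤s z≤n) n≥10)

  first-reply : (S₁ : List (Edge n)) → LegalBreakerMove b [] [] S₁ → MakerWinsM b [] (S₁ ++ [])
  first-reply S₁ legal₁
    with length<n⇒∃∉ (v ∷ neighbours v (S₁ ++ []))
                     (≤-trans (s≤s (s≤s (legal-degree legal₁ z≤n))) (≤-trans (m≤m+n 3 7) n≥10))
  ... | a , a∉ = stepM (edge v a) (edge-isEdge v≢a , (λ ()) , va∉B₁) (stepB second-reply)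
    where
    v≢a : v ≢ a
    v≢a v≡a = a∉ (here (sym v≡a))
    va∉B₁ : edge v a ∉ S₁ ++ []
    va∉B₁ = a∉ ∘ there ∘ edge∈⇒neighbour
    second-reply : (S₂ : List (Edge n)) → LegalBreakerMove b (edge v a ∷ []) (S₁ ++ []) S₂ →
                   MakerWinsM b (edge v a ∷ []) (S₂ ++ S₁ ++ [])
    second-reply S₂ legal₂ =
      ThirdMove.maker-wins b n≥10 v≢a
        (legal-edges legal₂ (legal-edges legal₁ []))
        (legal-∉ legal₂ (here refl) va∉B₁)
        (λ _ → legal-degree legal₂ (legal-degree legal₁ z≤n))

theorem4p1 : (n : ℕ) → 10 ≤ n → MakerWinsTriangleGame n ⌊ n /2⌋
theorem4p1 n = maker-wins-K₃-game ⌊ n /2⌋
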